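{- Let $R$ be a finite, dwindling, convergent string rewriting system over a finite alphabet $\Sigma$ such that the right-hand side of every rule of $R$ has length at most $1$, and let $\alpha \in \Sigma^+$ be irreducible with respect to $R$. Then every minimal-length string $W\in\Sigma^*$ with $\alpha W \rightarrow_R^! W$ is a prefix of $\alpha$.
   Context: A string rewriting system $R$ over $\Sigma$ is a set of rules $l \rightarrow r$ ($l,r\in\Sigma^*$), with $u \rightarrow_R v$ iff $u = xly$, $v = xry$ for some rule and $x,y\in\Sigma^*$. $R$ is convergent if terminating and confluent; dwindling if for each rule $l\rightarrow r$, $r$ is a proper prefix of $l$. A string is irreducible if no rule applies to it; $u \rightarrow_R^! v$ means $u \rightarrow_R^* v$ with $v$ irreducible. -}

module Defs where

open import Data.Nat using (ℕ; _≤_; _<_)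
open import Data.Fin using (Fin)
open import Data.List using (List; []; _∷_; _++_; length)
open import Data.List.Membership.Propositional using (_∈_)
open import Data.Product using (_×_; _,_; ∃; ∃-syntax; Σ-syntax)
open import Relation.Binary.PropositionalEquality using (_≡_)
open import Relation.Binary.Construct.Closure.ReflexiveTransitive using (Star)
open import Relation.Nullary using (¬_)
open import Induction.WellFounded using (WellFounded)

Str : ℕ → Set
Str k = List (Fin k)

Rule : ℕ → Set
Rule k = Str k × Str k

SRS : ℕ → Set
SRS k = List (Rule k)

data Step {k : ℕ} (R : SRS k) : Str k → Str k → Set where
  step : ∀ {l r} (x y : Str k) → (l , r) ∈ R →
         Step R (x ++ l ++ y) (x ++ r ++ y)

Steps : ∀ {k} → SRS k → Str k → Str k → Set
Steps R = Star (Step R)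

Irreducible : ∀ {k} → SRS k → Str k → Set
Irreducible R u = ∀ v → ¬ Step R u v

NormalForm : ∀ {k} → SRS k → Str k → Str k → Set
NormalForm R u v = Steps R u v × Irreducible R v

Terminating : ∀ {k} → SRS k → Set
Terminating R = WellFounded (λ v u → Step R u v)

Confluent : ∀ {k} → SRS k → Set
Confluent R = ∀ {u v w} → Steps R u v → Steps R u w →
              ∃[ z ] (Steps R v z × Steps R w z)

Convergent : ∀ {k} → SRS k → Set
Convergent R = Terminating R × Confluent R

ProperPrefix : ∀ {k} → Str k → Str k → Set
ProperPrefix r l = ∃[ z ] (r ++ z ≡ l × ¬ (z ≡ []))

Dwindling : ∀ {k} → SRS k → Set
Dwindling R = ∀ {l r} → (l , r) ∈ R → ProperPrefix r l

RhsAtMostOne : ∀ {k} → SRS k → Set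
RhsAtMostOne R = ∀ {l r} → (l , r) ∈ R → length r ≤ 1

Prefix : ∀ {k} → Str k → Str k → Set
Prefix u w = ∃[ z ] (u ++ z ≡ w)

-- Append W to α one letter at a time. As long as the word built so far stays irreducible
-- nothing happens; once a redex appears it must end at the new letter and, because the
-- appended part of W is irreducible, start inside α. Since right-hand sides are prefixes
-- of length at most one, that rewrite leaves a prefix of α, and the process continues from
-- there. So the normal form of αW is either αW itself (impossible, as it equals W and α is
-- nonempty) or p'W₂ with W = W₁W₂ and αW₁ →! p' a prefix of α. Then W₁ = p' is itself a
-- solution, and minimality of W forces W₂ to be empty.
module Submission where

open import Defs
open import Data.Nat using (ℕ; _≤_; s≤s)
open import Data.Fin using (Fin; _≟_)
open import Data.List using (List; []; _∷_; _++_; [_]; length; initLast; _∷ʳ′_)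
open import Data.List.Properties using (++-assoc; ++-identityʳ; ++-cancelʳ; ++-identityˡ-unique; ∷-injective; ∷-injectiveˡ; ∷ʳ-injectiveˡ; ++-monoid)
open import Data.List.Membership.Propositional using (_∈_; find; lose)
open import Data.List.Relation.Unary.Any using (Any; any?)
open import Data.List.Relation.Binary.Suffix.Heterogeneous.Properties using (suffix?)
open import Data.List.Relation.Binary.Suffix.Propositional.Properties using (Suffix-as-∣ʳ; ∣ʳ-as-Suffix)
open import Data.Product using (_×_; _,_; ∃; ∃₂; proj₂)
open import Data.Sum using (_⊎_; inj₁; inj₂)
open import Data.Empty using (⊥; ⊥-elim)
open import Relation.Nullary using (¬_; Dec; yes; no)
open import Relation.Nullary.Decidable using (map′)
open import Relation.Binary.PropositionalEquality using (_≡_; refl; sym; trans; cong; subst; subst₂)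
open import Relation.Binary.Construct.Closure.ReflexiveTransitive using (ε; _◅_)
import Algebra.Properties.Monoid.Divisibility as Divisibility

module _ {A : Set} where

  ++-≡-++-cases : ∀ (x l p t : List A) → x ++ l ≡ p ++ t →
    (∃ λ m → x ≡ p ++ m × t ≡ m ++ l) ⊎ (∃₂ λ y m → p ≡ x ++ y ∷ m × l ≡ y ∷ m ++ t)
  ++-≡-++-cases x       l []      t e = inj₁ (x , refl , sym e)
  ++-≡-++-cases []      l (y ∷ p) t e = inj₂ (y , p , refl , e)
  ++-≡-++-cases (a ∷ x) l (b ∷ p) t e with ∷-injective e
  ... | refl , e′ with ++-≡-++-cases x l p t e′
  ...   | inj₁ (m , x≡pm , t≡ml)       = inj₁ (m , cong (a ∷_) x≡pm , t≡ml)
  ...   | inj₂ (y , m , p≡xym , l≡ymt) = inj₂ (y , m , cong (a ∷_) p≡xym , l≡ymt)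

  length-++-≤⇒≡[] : ∀ (xs ys : List A) → length (xs ++ ys) ≤ length xs → ys ≡ []
  length-++-≤⇒≡[] []       []  _       = refl
  length-++-≤⇒≡[] (_ ∷ xs) ys (s≤s h) = length-++-≤⇒≡[] xs ys h

module _ {k : ℕ} where

  Prefix-trans : {u v w : Str k} → Prefix u v → Prefix v w → Prefix u w
  Prefix-trans {u} (z , refl) (z′ , refl) = z ++ z′ , sym (++-assoc u z z′)

  Prefix-++ˡ : (x : Str k) {u v : Str k} → Prefix u v → Prefix (x ++ u) (x ++ v)
  Prefix-++ˡ x {u} (z , refl) = z , ++-assoc x u z

  Prefix-∷-++-short : ∀ {r} y (m t : Str k) → length r ≤ 1 → Prefix r (y ∷ m ++ t) → Prefix r (y ∷ m)
  Prefix-∷-++-short {[]}        y m t _           _       = y ∷ m , refl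
  Prefix-∷-++-short {a ∷ []}    y m t _           (_ , e) = m , cong (_∷ m) (∷-injectiveˡ e)
  Prefix-∷-++-short {_ ∷ _ ∷ _} y m t (s≤s ())    _

module _ {k : ℕ} (R : SRS k) where

  open Divisibility (++-monoid (Fin k)) using (_∣ʳ_; _,_)

  Step-++ʳ : ∀ {u v} (t : Str k) → Step R u v → Step R (u ++ t) (v ++ t)
  Step-++ʳ t (step {l} {r} x y l→r) = subst₂ (Step R) (reassoc l) (reassoc r) (step x (y ++ t) l→r)
    where
    reassoc : ∀ s → x ++ s ++ y ++ t ≡ (x ++ s ++ y) ++ t
    reassoc s = sym (trans (++-assoc x (s ++ y) t) (cong (x ++_) (++-assoc s y t)))

  Step-++ˡ : ∀ {u v} (t : Str k) → Step R u v → Step R (t ++ u) (t ++ v)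
  Step-++ˡ t (step {l} {r} x y l→r) =
    subst₂ (Step R) (++-assoc t x (l ++ y)) (++-assoc t x (r ++ y)) (step (t ++ x) y l→r)

  Step-rule : ∀ {l r} (x : Str k) → (l , r) ∈ R → Step R (x ++ l) (x ++ r)
  Step-rule {l} {r} x l→r =
    subst₂ (Step R) (cong (x ++_) (++-identityʳ l)) (cong (x ++_) (++-identityʳ r)) (step x [] l→r)

  Irreducible-prefix : ∀ {u s} → Prefix u s → Irreducible R s → Irreducible R u
  Irreducible-prefix (z , refl) s-irr v u→v = s-irr (v ++ z) (Step-++ʳ z u→v)

  Irreducible-++⁻ʳ : ∀ (t : Str k) {u} → Irreducible R (t ++ u) → Irreducible R u
  Irreducible-++⁻ʳ t tu-irr v u→v = tu-irr (t ++ v) (Step-++ˡ t u→v)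

  Steps-irreducible-≡ : ∀ {u v} → Irreducible R u → Steps R u v → v ≡ u
  Steps-irreducible-≡ u-irr ε         = refl
  Steps-irreducible-≡ u-irr (u→w ◅ _) = ⊥-elim (u-irr _ u→w)

  NormalForm-reduct : Confluent R → ∀ {s t g} → NormalForm R s g → Steps R s t → NormalForm R t g
  NormalForm-reduct confluent (s→g , g-irr) s→t with confluent s→g s→t
  ... | z , g→z , t→z = subst (Steps R _) (Steps-irreducible-≡ g-irr g→z) t→z , g-irr

  -- In the list monoid, l ∣ʳ s means s ≡ x ++ l: l is a suffix of s.
  SuffixRedex : Str k → Set
  SuffixRedex s = Any (λ (l , _) → l ∣ʳ s) R

  suffixRedex? : ∀ s → Dec (SuffixRedex s)
  suffixRedex? s = any? (λ (l , _) → map′ Suffix-as-∣ʳ ∣ʳ-as-Suffix (suffix? _≟_ l s)) R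

  -- A redex of q c that does not end at c is already a redex of q.
  Irreducible-∷ʳ : ∀ {q c} → Irreducible R q → ¬ SuffixRedex (q ++ [ c ]) → Irreducible R (q ++ [ c ])
  Irreducible-∷ʳ {q} {c} q-irr no-redex _ qc→v = redex-absurd qc→v refl
    where
    redex-absurd : ∀ {s v} → Step R s v → s ≡ q ++ [ c ] → ⊥
    redex-absurd (step {l} x y l→r) e with initLast y
    ... | []       = no-redex (lose l→r (x , trans (cong (x ++_) (sym (++-identityʳ l))) e))
    ... | ys ∷ʳ′ d = subst (Irreducible R) q≡xlys q-irr _ (step x ys l→r)
      where
      q≡xlys : q ≡ x ++ l ++ ys
      q≡xlys = sym (∷ʳ-injectiveˡ (x ++ l ++ ys) q
        (trans (++-assoc x (l ++ ys) [ d ]) (trans (cong (x ++_) (++-assoc l ys [ d ])) e)))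

  data NormalFormShape (p w u g : Str k) : Set where
    unchanged : g ≡ p ++ w ++ u → NormalFormShape p w u g
    collapsed : ∀ {u₁ u₂ p′} → u ≡ u₁ ++ u₂ → NormalForm R (p ++ w ++ u₁) p′ → Prefix p′ p →
                g ≡ p′ ++ u₂ → NormalFormShape p w u g

  module _ (dwindling : Dwindling R) (short-rhs : RhsAtMostOne R) where

    suffixRedex-collapse : ∀ p w {c} → Irreducible R (w ++ [ c ]) → SuffixRedex (p ++ w ++ [ c ]) →
      ∃ λ v → Step R (p ++ w ++ [ c ]) v × Prefix v p
    suffixRedex-collapse p w {c} wc-irr redex with find redex
    ... | (l , r) , l→r , (x , xl≡pwc) with ++-≡-++-cases x l p (w ++ [ c ]) xl≡pwc
    ...   | inj₁ (m , _ , wc≡ml) = ⊥-elim (subst (Irreducible R) wc≡ml wc-irr _ (Step-rule m l→r))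
    ...   | inj₂ (y , m , p≡xym , l≡ympc) =
      x ++ r , subst (λ s → Step R s (x ++ r)) xl≡pwc (Step-rule x l→r) ,
      subst (Prefix (x ++ r)) (sym p≡xym) (Prefix-++ˡ x (Prefix-∷-++-short y m (w ++ [ c ]) (short-rhs l→r) r≼l))
      where
      r≼l : Prefix r (y ∷ m ++ w ++ [ c ])
      r≼l with dwindling l→r
      ... | z , rz≡l , _ = z , trans rz≡l l≡ympc

    module _ (confluent : Confluent R) where

      normalForm-shape : ∀ p w u {g} → Irreducible R (p ++ w) → Irreducible R (w ++ u) →
        NormalForm R (p ++ w ++ u) g → NormalFormShape p w u g
      normalForm-shape p w [] pw-irr _ (pw→g , _) =
        unchanged (Steps-irreducible-≡ (subst (λ t → Irreducible R (p ++ t)) (sym (++-identityʳ w)) pw-irr) pw→g)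
      normalForm-shape p w (c ∷ u) {g} pw-irr wcu-irr nf with suffixRedex? (p ++ w ++ [ c ])
      ... | no no-redex = shift (normalForm-shape p (w ++ [ c ]) u pwc-irr wc-u-irr nf′)
        where
        pwc-irr : Irreducible R (p ++ w ++ [ c ])
        pwc-irr = subst (Irreducible R) (++-assoc p w [ c ])
          (Irreducible-∷ʳ pw-irr (λ redex → no-redex (subst SuffixRedex (++-assoc p w [ c ]) redex)))
        wc-u-irr : Irreducible R ((w ++ [ c ]) ++ u)
        wc-u-irr = subst (Irreducible R) (sym (++-assoc w [ c ] u)) wcu-irr
        nf′ : NormalForm R (p ++ (w ++ [ c ]) ++ u) g
        nf′ = subst (λ s → NormalForm R (p ++ s) g) (sym (++-assoc w [ c ] u)) nf
        shift : NormalFormShape p (w ++ [ c ]) u g → NormalFormShape p w (c ∷ u) g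
        shift (unchanged g≡) = unchanged (trans g≡ (cong (p ++_) (++-assoc w [ c ] u)))
        shift (collapsed {u₁} u≡ nf₁ p′≼p g≡) =
          collapsed (cong (c ∷_) u≡) (subst (λ s → NormalForm R (p ++ s) _) (++-assoc w [ c ] u₁) nf₁) p′≼p g≡
      ... | yes redex with suffixRedex-collapse p w (Irreducible-prefix (u , ++-assoc w [ c ] u) wcu-irr) redex
      ...   | v , pwc→v , v≼p =
        descend (normalForm-shape v [] u v[]-irr u-irr (NormalForm-reduct confluent nf (pwc-step u ◅ ε)))
        where
        v-irr : Irreducible R v
        v-irr = Irreducible-prefix (Prefix-trans v≼p (w , refl)) pw-irr
        v[]-irr : Irreducible R (v ++ [])
        v[]-irr = subst (Irreducible R) (sym (++-identityʳ v)) v-irr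
        u-irr : Irreducible R u
        u-irr = Irreducible-++⁻ʳ [ c ] (Irreducible-++⁻ʳ w wcu-irr)
        pwc-step : ∀ t → Step R (p ++ w ++ c ∷ t) (v ++ t)
        pwc-step t = subst (λ s → Step R s (v ++ t))
          (trans (++-assoc p (w ++ [ c ]) t) (cong (p ++_) (++-assoc w [ c ] t))) (Step-++ʳ t pwc→v)
        descend : NormalFormShape v [] u g → NormalFormShape p w (c ∷ u) g
        descend (unchanged g≡) = collapsed refl (pwc→v ◅ ε , v-irr) v≼p g≡
        descend (collapsed u≡ (v→p′ , p′-irr) p′≼v g≡) =
          collapsed (cong (c ∷_) u≡) (pwc-step _ ◅ v→p′ , p′-irr) (Prefix-trans p′≼v v≼p) g≡

corollary1p9 : (k : ℕ) (R : SRS k) → Convergent R → Dwindling R → RhsAtMostOne R →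
    (α : Str k) → ¬ (α ≡ []) → Irreducible R α →
    (W : Str k) → NormalForm R (α ++ W) W →
    (∀ (V : Str k) → NormalForm R (α ++ V) V → length W ≤ length V) →
    Prefix W α
corollary1p9 k R (_ , confluent) dwindling short-rhs α α≢[] α-irr W nf minimal
  with normalForm-shape R dwindling short-rhs confluent α [] W
         (subst (Irreducible R) (sym (++-identityʳ α)) α-irr) (proj₂ nf) nf
... | unchanged W≡αW = ⊥-elim (α≢[] (++-identityˡ-unique α W≡αW))
... | collapsed {u₁} {u₂} {p′} W≡u₁u₂ nf′ p′≼α W≡p′u₂ = subst (λ s → Prefix s α) (sym W≡p′) p′≼α
  where
  u₁≡p′ : u₁ ≡ p′
  u₁≡p′ = ++-cancelʳ u₂ u₁ p′ (trans (sym W≡u₁u₂) W≡p′u₂)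
  |W|≤|p′| : length W ≤ length p′
  |W|≤|p′| = minimal p′ (subst (λ s → NormalForm R (α ++ s) p′) u₁≡p′ nf′)
  u₂≡[] : u₂ ≡ []
  u₂≡[] = length-++-≤⇒≡[] p′ u₂ (subst (λ s → length s ≤ length p′) W≡p′u₂ |W|≤|p′|)
  W≡p′ : W ≡ p′
  W≡p′ = trans W≡p′u₂ (trans (cong (p′ ++_) u₂≡[]) (++-identityʳ p′))
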